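{- Let $\mathcal{H}=(V,E)$ be a hypergraph in which each hyperedge $e\in E$ is equipped with a cardinality-based splitting function $\mathbf{w}_e$. Then the generalized hypergraph minimum $s$-$t$ cut problem on $\mathcal{H}$ is graph reducible if and only if $\mathbf{w}_e$ is submodular for every $e\in E$.
   Context: A hypergraph $\mathcal{H}=(V,E)$ has a finite vertex set $V$ and hyperedges $e\in E$ that are subsets of $V$. A (hyperedge) splitting function on $e$ is a function $\mathbf{w}_e:2^e\to\mathbb{R}$ with $\mathbf{w}_e(S)\ge 0$ for all $S\subseteq e$, $\mathbf{w}_e(S)=\mathbf{w}_e(e\setminus S)$ for all $S\subseteq e$ (symmetry), and $\mathbf{w}_e(e)=\mathbf{w}_e(\emptyset)=0$. It is submodular if $\mathbf{w}_e(S_1)+\mathbf{w}_e(S_2)\ge \mathbf{w}_e(S_1\cap S_2)+\mathbf{w}_e(S_1\cup S_2)$ for all $S_1,S_2\subseteq e$, and cardinality-based if $\mathbf{w}_e(S_1)=\mathbf{w}_e(S_2)$ whenever $|S_1|=|S_2|$. Given distinct $s,t\in V$, the generalized hypergraph minimum $s$-$t$ cut problem is to minimize $\mathrm{cut}_{\mathcal{H}}(S)=\sum_{e\in E}\mathbf{w}_e(e\cap S)$ over $S\subseteq V$ with $s\in S$, $t\notin S$. A hyperedge $s$-$t$ cut gadget on $e$ is a graph $G_e=(V',E')$ with $V'=e\cup\hat V$ ($\hat V$ a set of auxiliary nodes disjoint from $e$) and a set $E'$ of possibly directed edges with nonnegative weights $w_{ij}$; its gadget splitting function is $\hat{\mathbf{w}}_e(S)=\min_{T\subseteq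 V',\,T\cap e=S}\mathrm{cut}_{G_e}(T)$ for $S\subseteq e$, where $\mathrm{cut}_{G_e}(T)=\sum_{i\in T}\sum_{j\in V'\setminus T}w_{ij}$ (for directed edges only edges from $T$ to $V'\setminus T$ count). A splitting function $\mathbf{w}_e$ is modeled by the gadget if $\hat{\mathbf{w}}_e=\mathbf{w}_e$. The problem on $\mathcal{H}$ is graph reducible if every $\mathbf{w}_e$, $e\in E$, is modeled by some hyperedge $s$-$t$ cut gadget.
   Formalization: The splitting functions $\mathbf{w}_e$ and the gadget edge weights $w_{ij}$ take values in ℚ rather than ℝ. -}

module Defs where

open import Data.Nat using (ℕ; zero; suc; _+_)
open import Data.Fin using (Fin; zero; suc)
open import Data.Fin.Subset using (Subset; ⊥; ⊤; ∁; _∩_; _∪_; ∣_∣)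
open import Data.Vec using (Vec; lookup; take; tabulate)
open import Data.Bool using (Bool; true; false; if_then_else_; _∧_; not)
open import Data.Rational using (ℚ; 0ℚ; _≤_) renaming (_+_ to _+ℚ_)
open import Data.Product using (Σ; ∃; _×_; _,_)
open import Relation.Binary.PropositionalEquality using (_≡_)
open import Function.Definitions using (Injective)

sumFin : (N : ℕ) → (Fin N → ℚ) → ℚ
sumFin zero    f = 0ℚ
sumFin (suc N) f = f zero +ℚ sumFin N (λ i → f (suc i))

-- Splitting functions on a hyperedge with k elements.
-- Subsets of the hyperedge are represented as  Subset k  (the hyperedge's
-- elements are indexed by Fin k).

IsSplittingFunction : ∀ {k} → (Subset k → ℚ) → Set
IsSplittingFunction w =
  (∀ S → 0ℚ ≤ w S) × (∀ S → w S ≡ w (∁ S)) × (w ⊤ ≡ 0ℚ) × (w ⊥ ≡ 0ℚ)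

IsSubmodular : ∀ {k} → (Subset k → ℚ) → Set
IsSubmodular w = ∀ S₁ S₂ → w (S₁ ∩ S₂) +ℚ w (S₁ ∪ S₂) ≤ w S₁ +ℚ w S₂

IsCardinalityBased : ∀ {k} → (Subset k → ℚ) → Set
IsCardinalityBased w = ∀ S₁ S₂ → ∣ S₁ ∣ ≡ ∣ S₂ ∣ → w S₁ ≡ w S₂

-- Node set V' = e ∪ V̂ is Fin (k + aux):
-- the first k nodes are the hyperedge's nodes, the remaining aux nodes
-- are auxiliary.  Edges are directed with nonnegative weights given by a
-- weight matrix (an undirected edge = two opposite directed edges;
-- parallel edges = summed weight; absent edge = weight 0).

record Gadget (k : ℕ) : Set where
  field
    aux           : ℕ
    weight        : Fin (k + aux) → Fin (k + aux) → ℚ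
    weight-nonneg : ∀ i j → 0ℚ ≤ weight i j
open Gadget public

gadgetCut : ∀ {k} (G : Gadget k) → Subset (k + aux G) → ℚ
gadgetCut {k} G T =
  sumFin (k + aux G) λ i → sumFin (k + aux G) λ j →
    if lookup T i ∧ not (lookup T j) then weight G i j else 0ℚ

-- G models w:  w(S) = min { cut_G(T) : T ∩ e = S }  for every S ⊆ e,
-- i.e. the minimum is attained at some T and is a lower bound for all T.
Models : ∀ {k} → Gadget k → (Subset k → ℚ) → Set
Models {k} G w =
  ∀ (S : Subset k) →
    (Σ (Subset (k + aux G)) λ T → (take k T ≡ S) × (gadgetCut G T ≡ w S))
    × (∀ (T : Subset (k + aux G)) → take k T ≡ S → w S ≤ gadgetCut G T)

record Hypergraph (n : ℕ) : Set where
  field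
    m          : ℕ
    size       : Fin m → ℕ
    member     : (e : Fin m) → Fin (size e) → Fin n
    member-inj : ∀ e → Injective _≡_ _≡_ (member e)
open Hypergraph public

SplittingFunctions : ∀ {n} → Hypergraph n → Set
SplittingFunctions H = (e : Fin (m H)) → Subset (size H e) → ℚ

-- e ∩ S, as a subset of the hyperedge's index set.
restrict : ∀ {n} (H : Hypergraph n) (e : Fin (m H)) → Subset n → Subset (size H e)
restrict H e S = tabulate λ i → lookup S (member H e i)

cutH : ∀ {n} (H : Hypergraph n) → SplittingFunctions H → Subset n → ℚ
cutH H w S = sumFin (m H) λ e → w e (restrict H e S)

GraphReducible : ∀ {n} (H : Hypergraph n) → SplittingFunctions H → Set
GraphReducible H w = ∀ e → Σ (Gadget (size H e)) λ G → Models G (w e)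

-- A gadget's cut function is submodular edge by edge, so if G models w then w(S₁ ∩ S₂) + w(S₁ ∪ S₂)
-- is at most the cut of the intersection plus the cut of the union of optimal extensions T₁, T₂ of
-- S₁, S₂, which is at most cut(T₁) + cut(T₂) = w(S₁) + w(S₂).
--
-- Conversely, a cardinality-based w is w(S) = g(|S|) with g(0) = g(k) = 0, and submodularity makes g
-- concave: δ²g(j) = 2g(j) − g(j−1) − g(j+1) ≥ 0.  The tents t_j(c) = min(j(k−c), c(k−j)) vanish at
-- j = 0 and j = k and, for 0 < c < k, have second difference in j equal to k at j = c and 0
-- elsewhere, so summation by parts gives k·g(c) = Σ_j δ²g(j) t_j(c).  Finally t_j(|S|) is the minimal cut at one auxiliary node
-- with an edge of weight k − j from every node of the hyperedge to it and one of weight j back; one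
-- such node per j, with weights scaled by δ²g(j)/k, models w.

{-# OPTIONS --safe #-}
module Submission where

open import Defs
open import Data.Nat using (ℕ)
open import Data.Fin using (Fin)
open import Function.Bundles using (_⇔_)

open import Algebra.Bundles using (CommutativeRing)
open import Data.Bool using (Bool; true; false; if_then_else_; _∧_; _∨_; not)
import Data.Bool.Properties as Bool
open import Data.Empty using (⊥-elim)
open import Data.Fin as Fin using (zero; suc; toℕ; splitAt; fromℕ<)
import Data.Fin.Properties as Fin
open import Data.Fin.Subset using (Subset; ∁; _∩_; _∪_; ∣_∣) renaming (⊥ to ∅; ⊤ to full)
open import Data.Fin.Subset.Properties using (∩-idem; ∪-idem; ∣⊥∣≡0; ∣p∣≤n; ∣∁p∣≡n∸∣p∣)
open import Data.Nat as ℕ using (zero; suc; z≤n; s≤s; _⊓_)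
import Data.Nat.Properties as ℕ
open import Data.Product using (Σ; _,_; proj₁; proj₂)
open import Data.Rational as ℚ using (ℚ; 0ℚ; 1ℚ; _≤_; _+_; _*_; _-_; 1/_)
import Data.Rational.Properties as ℚ
open import Data.Sum as Sum using (_⊎_; inj₁; inj₂; [_,_]′)
open import Data.Vec using (Vec; []; _∷_; lookup; take; drop; _++_; tabulate)
import Data.Vec.Properties as Vec
open import Function using (_∘_; mk⇔)
open import Level using (0ℓ)
open import Relation.Binary.Definitions using (tri<; tri≈; tri>)
open import Relation.Binary.PropositionalEquality
open import Relation.Nullary.Reflects using (ofʸ; ofⁿ)
open import Relation.Nullary.Decidable using (dec⇒maybe)
open import Tactic.RingSolver using (solve-∀)
import Tactic.RingSolver.Core.AlmostCommutativeRing as ACR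

open import Algebra.Properties.Semiring.Sum (CommutativeRing.semiring ℚ.+-*-commutativeRing)
  using (sum; sum-syntax; sum-cong-≗; sum-replicate-zero; sum-init-last; sum-remove;
         ∑-distrib-+; ∑-comm; *-distribˡ-sum)

ℚ-ring : ACR.AlmostCommutativeRing 0ℓ 0ℓ
ℚ-ring = ACR.fromCommutativeRing ℚ.+-*-commutativeRing (dec⇒maybe ∘ (0ℚ ℚ.≟_))

*-nonneg : ∀ {p q} → 0ℚ ≤ p → 0ℚ ≤ q → 0ℚ ≤ p * q
*-nonneg {p} {q} 0≤p 0≤q =
  ℚ.nonNegative⁻¹ (p * q) {{ℚ.nonNeg*nonNeg⇒nonNeg p {{ℚ.nonNegative 0≤p}} q {{ℚ.nonNegative 0≤q}}}}

p≤q⇒0≤q-p : ∀ {p q} → p ≤ q → 0ℚ ≤ q - p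
p≤q⇒0≤q-p {p} {q} p≤q = subst (_≤ q - p) (ℚ.+-inverseʳ p) (ℚ.+-monoˡ-≤ (ℚ.- p) p≤q)

fromℕ : ℕ → ℚ
fromℕ zero    = 0ℚ
fromℕ (suc n) = 1ℚ + fromℕ n

fromℕ-+ : ∀ m n → fromℕ (m ℕ.+ n) ≡ fromℕ m + fromℕ n
fromℕ-+ zero    n = sym (ℚ.+-identityˡ (fromℕ n))
fromℕ-+ (suc m) n = trans (cong (1ℚ +_) (fromℕ-+ m n)) (sym (ℚ.+-assoc 1ℚ (fromℕ m) (fromℕ n)))

fromℕ-* : ∀ m n → fromℕ (m ℕ.* n) ≡ fromℕ m * fromℕ n
fromℕ-* zero    n = sym (ℚ.*-zeroˡ (fromℕ n))
fromℕ-* (suc m) n = begin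
  fromℕ (n ℕ.+ m ℕ.* n)          ≡⟨ fromℕ-+ n (m ℕ.* n) ⟩
  fromℕ n + fromℕ (m ℕ.* n)      ≡⟨ cong (fromℕ n +_) (fromℕ-* m n) ⟩
  fromℕ n + fromℕ m * fromℕ n    ≡⟨ distrib (fromℕ n) (fromℕ m) ⟩
  (1ℚ + fromℕ m) * fromℕ n       ∎
  where
  open ≡-Reasoning
  distrib : ∀ x y → x + y * x ≡ (1ℚ + y) * x
  distrib = solve-∀ ℚ-ring

fromℕ-∸ : ∀ {m n} → n ℕ.≤ m → fromℕ (m ℕ.∸ n) ≡ fromℕ m - fromℕ n
fromℕ-∸ {m} z≤n = sym (ℚ.+-identityʳ (fromℕ m))
fromℕ-∸ {suc m} {suc n} (s≤s n≤m) = trans (fromℕ-∸ n≤m) (shift (fromℕ m) (fromℕ n))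
  where
  shift : ∀ x y → x - y ≡ (1ℚ + x) - (1ℚ + y)
  shift = solve-∀ ℚ-ring

fromℕ-nonneg : ∀ n → 0ℚ ≤ fromℕ n
fromℕ-nonneg zero    = ℚ.≤-refl
fromℕ-nonneg (suc n) = ℚ.+-mono-≤ (ℚ.nonNegative⁻¹ 1ℚ) (fromℕ-nonneg n)

fromℕ-mono-≤ : ∀ {m n} → m ℕ.≤ n → fromℕ m ≤ fromℕ n
fromℕ-mono-≤ {n = n} z≤n = fromℕ-nonneg n
fromℕ-mono-≤ (s≤s m≤n)   = ℚ.+-monoʳ-≤ 1ℚ (fromℕ-mono-≤ m≤n)

fromℕ-suc-positive : ∀ n → ℚ.Positive (fromℕ (suc n))
fromℕ-suc-positive n = ℚ.positive (ℚ.+-mono-<-≤ (ℚ.positive⁻¹ 1ℚ) (fromℕ-nonneg n))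

fromℕ-suc-nonZero : ∀ n → ℚ.NonZero (fromℕ (suc n))
fromℕ-suc-nonZero n = ℚ.pos⇒nonZero (fromℕ (suc n)) {{fromℕ-suc-positive n}}

-- 1/fromℕ 0 = 0 is a junk value; it only ever scales a sum over Fin 0.
1/fromℕ : ℕ → ℚ
1/fromℕ zero    = 0ℚ
1/fromℕ (suc n) = (1/ fromℕ (suc n)) {{fromℕ-suc-nonZero n}}

1/fromℕ-nonneg : ∀ n → 0ℚ ≤ 1/fromℕ n
1/fromℕ-nonneg zero    = ℚ.≤-refl
1/fromℕ-nonneg (suc n) =
  ℚ.<⇒≤ (ℚ.positive⁻¹ _ {{ℚ.1/pos⇒pos (fromℕ (suc n)) {{fromℕ-suc-positive n}}}})

1/fromℕ-cancelˡ : ∀ n x → 1/fromℕ (suc n) * (fromℕ (suc n) * x) ≡ x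
1/fromℕ-cancelˡ n x = begin
  1/fromℕ (suc n) * (fromℕ (suc n) * x)  ≡⟨ ℚ.*-assoc (1/fromℕ (suc n)) _ x ⟨
  1/fromℕ (suc n) * fromℕ (suc n) * x    ≡⟨ cong (_* x) (ℚ.*-inverseˡ (fromℕ (suc n)) {{fromℕ-suc-nonZero n}}) ⟩
  1ℚ * x                                 ≡⟨ ℚ.*-identityˡ x ⟩
  x                                      ∎
  where open ≡-Reasoning

sumFin≡∑ : ∀ N (f : Fin N → ℚ) → sumFin N f ≡ ∑[ i < N ] f i
sumFin≡∑ zero    f = refl
sumFin≡∑ (suc N) f = cong (f zero +_) (sumFin≡∑ N (f ∘ suc))

∑-mono-≤ : ∀ {n} {f g : Fin n → ℚ} → (∀ i → f i ≤ g i) → sum f ≤ sum g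
∑-mono-≤ {zero}  f≤g = ℚ.≤-refl
∑-mono-≤ {suc n} f≤g = ℚ.+-mono-≤ (f≤g zero) (∑-mono-≤ (f≤g ∘ suc))

∑-mono-+ : ∀ {n} {f g h l : Fin n → ℚ} → (∀ i → f i + g i ≤ h i + l i) →
           sum f + sum g ≤ sum h + sum l
∑-mono-+ {f = f} {g} {h} {l} le = subst₂ _≤_ (∑-distrib-+ f g) (∑-distrib-+ h l) (∑-mono-≤ le)

∑-splitAt : ∀ k {m} (f : Fin k ⊎ Fin m → ℚ) →
            ∑[ x < k ℕ.+ m ] f (splitAt k x) ≡ ∑[ v < k ] f (inj₁ v) + ∑[ j < m ] f (inj₂ j)
∑-splitAt zero    f = sym (ℚ.+-identityˡ _)
∑-splitAt (suc k) {m} f =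
  trans (cong (f (inj₁ zero) +_) (∑-splitAt k (f ∘ Sum.map₁ suc)))
        (sym (ℚ.+-assoc (f (inj₁ zero)) (∑[ v < k ] f (inj₁ (suc v))) (∑[ j < m ] f (inj₂ j))))

∑-snoc : ∀ n (f : ℕ → ℚ) → ∑[ j < suc n ] f (toℕ j) ≡ ∑[ j < n ] f (toℕ j) + f n
∑-snoc n f = trans (sum-init-last {n} (f ∘ toℕ))
  (cong₂ _+_ (sum-cong-≗ {n} (cong f ∘ Fin.toℕ-inject₁)) (cong f (Fin.toℕ-fromℕ n)))

∑-single : ∀ {n} (f : Fin n → ℚ) i → (∀ j → j ≢ i → f j ≡ 0ℚ) → sum f ≡ f i
∑-single {suc n} f i f≡0 = begin
  sum f                                 ≡⟨ sum-remove f ⟩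
  f i + ∑[ j < n ] f (Fin.punchIn i j)  ≡⟨ cong (f i +_) (sum-cong-≗ {n} (λ j → f≡0 _ (Fin.punchInᵢ≢i i j))) ⟩
  f i + ∑[ j < n ] 0ℚ                   ≡⟨ cong (f i +_) (sum-replicate-zero n) ⟩
  f i + 0ℚ                              ≡⟨ ℚ.+-identityʳ (f i) ⟩
  f i                                   ∎
  where open ≡-Reasoning

∑-count : ∀ {k} (S : Subset k) x → ∑[ v < k ] (if lookup S v then x else 0ℚ) ≡ fromℕ ∣ S ∣ * x
∑-count []          x = sym (ℚ.*-zeroˡ x)
∑-count (true ∷ S)  x = trans (cong (x +_) (∑-count S x)) (distrib x (fromℕ ∣ S ∣))
  where
  distrib : ∀ x y → x + y * x ≡ (1ℚ + y) * x
  distrib = solve-∀ ℚ-ring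
∑-count (false ∷ S) x = trans (ℚ.+-identityˡ _) (∑-count S x)

-- Cut functions of gadgets are submodular

edgeCut : Bool → Bool → ℚ → ℚ
edgeCut a b x = if a ∧ not b then x else 0ℚ

edgeCut-0 : ∀ a b → edgeCut a b 0ℚ ≡ 0ℚ
edgeCut-0 a b with a ∧ not b
... | true  = refl
... | false = refl

gadgetCut≡∑ : ∀ {k} (G : Gadget k) T →
  gadgetCut G T ≡ ∑[ i < k ℕ.+ aux G ] ∑[ j < k ℕ.+ aux G ] edgeCut (lookup T i) (lookup T j) (weight G i j)
gadgetCut≡∑ {k} G T = trans (sumFin≡∑ N _) (sum-cong-≗ {N} λ i → sumFin≡∑ N _)
  where
  N : ℕ
  N = k ℕ.+ aux G

edgeCut-submodular : ∀ a b c d {x} → 0ℚ ≤ x →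
  edgeCut (a ∧ b) (c ∧ d) x + edgeCut (a ∨ b) (c ∨ d) x ≤ edgeCut a c x + edgeCut b d x
edgeCut-submodular false false c     d     _   = ℚ.≤-refl
edgeCut-submodular true  true  true  true  _   = ℚ.≤-refl
edgeCut-submodular true  true  true  false {x} _ = ℚ.≤-reflexive (ℚ.+-comm x 0ℚ)
edgeCut-submodular true  true  false true  _   = ℚ.≤-refl
edgeCut-submodular true  true  false false _   = ℚ.≤-refl
edgeCut-submodular true  false true  d     _   = ℚ.≤-refl
edgeCut-submodular true  false false true  0≤x = ℚ.+-mono-≤ 0≤x ℚ.≤-refl
edgeCut-submodular true  false false false {x} _ = ℚ.≤-reflexive (ℚ.+-comm 0ℚ x)
edgeCut-submodular false true  true  true  _   = ℚ.≤-refl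
edgeCut-submodular false true  false true  _   = ℚ.≤-refl
edgeCut-submodular false true  true  false 0≤x = ℚ.+-mono-≤ ℚ.≤-refl 0≤x
edgeCut-submodular false true  false false _   = ℚ.≤-refl

gadgetCut-submodular : ∀ {k} (G : Gadget k) → IsSubmodular (gadgetCut G)
gadgetCut-submodular G T₁ T₂ =
  subst₂ _≤_ (sym (cong₂ _+_ (gadgetCut≡∑ G (T₁ ∩ T₂)) (gadgetCut≡∑ G (T₁ ∪ T₂))))
             (sym (cong₂ _+_ (gadgetCut≡∑ G T₁) (gadgetCut≡∑ G T₂)))
             (∑-mono-+ λ i → ∑-mono-+ λ j → edge i j)
  where
  edge : ∀ i j →
    edgeCut (lookup (T₁ ∩ T₂) i) (lookup (T₁ ∩ T₂) j) (weight G i j)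
      + edgeCut (lookup (T₁ ∪ T₂) i) (lookup (T₁ ∪ T₂) j) (weight G i j)
    ≤ edgeCut (lookup T₁ i) (lookup T₁ j) (weight G i j) + edgeCut (lookup T₂ i) (lookup T₂ j) (weight G i j)
  edge i j
    rewrite Vec.lookup-zipWith _∧_ i T₁ T₂ | Vec.lookup-zipWith _∧_ j T₁ T₂
          | Vec.lookup-zipWith _∨_ i T₁ T₂ | Vec.lookup-zipWith _∨_ j T₁ T₂
    = edgeCut-submodular (lookup T₁ i) (lookup T₂ i) (lookup T₁ j) (lookup T₂ j) (weight-nonneg G i j)

modeled⇒submodular : ∀ {k} {w : Subset k → ℚ} → Σ (Gadget k) (λ G → Models G w) → IsSubmodular w
modeled⇒submodular {k} {w} (G , models) S₁ S₂
  with proj₁ (models S₁) | proj₁ (models S₂)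
... | T₁ , T₁∩e≡S₁ , cut≡w₁ | T₂ , T₂∩e≡S₂ , cut≡w₂ = begin
  w (S₁ ∩ S₂) + w (S₁ ∪ S₂)
    ≤⟨ ℚ.+-mono-≤ (proj₂ (models (S₁ ∩ S₂)) (T₁ ∩ T₂) ∩-restricts)
                  (proj₂ (models (S₁ ∪ S₂)) (T₁ ∪ T₂) ∪-restricts) ⟩
  gadgetCut G (T₁ ∩ T₂) + gadgetCut G (T₁ ∪ T₂)
    ≤⟨ gadgetCut-submodular G T₁ T₂ ⟩
  gadgetCut G T₁ + gadgetCut G T₂
    ≡⟨ cong₂ _+_ cut≡w₁ cut≡w₂ ⟩
  w S₁ + w S₂ ∎
  where
  open ℚ.≤-Reasoning
  ∩-restricts : take k (T₁ ∩ T₂) ≡ S₁ ∩ S₂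
  ∩-restricts = trans (Vec.take-zipWith _∧_ T₁ T₂) (cong₂ _∩_ T₁∩e≡S₁ T₂∩e≡S₂)
  ∪-restricts : take k (T₁ ∪ T₂) ≡ S₁ ∪ S₂
  ∪-restricts = trans (Vec.take-zipWith _∨_ T₁ T₂) (cong₂ _∪_ T₁∩e≡S₁ T₂∩e≡S₂)

-- Summation by parts and tents

-- The negated second difference; δ² f 0 = 0 is a convention, harmless since every tent vanishes at 0.
δ² : (ℕ → ℚ) → ℕ → ℚ
δ² f zero    = 0ℚ
δ² f (suc j) = (f (suc j) + f (suc j)) - (f j + f (suc (suc j)))

δ²-cong : ∀ {f : ℕ → ℚ} i {a b c} → f i ≡ a → f (suc i) ≡ b → f (suc (suc i)) ≡ c →
          δ² f (suc i) ≡ (b + b) - (a + c)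
δ²-cong i refl refl refl = refl

casoratian : (ℕ → ℚ) → (ℕ → ℚ) → ℕ → ℚ
casoratian a b j = a j * b (suc j) - a (suc j) * b j

-- δ² a j * b j - a j * δ² b j = casoratian a b j - casoratian a b (j - 1) for j > 0, so the sum telescopes.
∑-δ²-by-parts : ∀ n (a b : ℕ → ℚ) →
  ∑[ j < suc n ] (δ² a (toℕ j) * b (toℕ j))
    ≡ ∑[ j < suc n ] (a (toℕ j) * δ² b (toℕ j)) + (casoratian a b n - casoratian a b 0)
∑-δ²-by-parts zero    a b = vanish (a 0) (b 0) (a 1) (b 1)
  where
  vanish : ∀ a₀ b₀ a₁ b₁ → 0ℚ * b₀ + 0ℚ ≡ (a₀ * 0ℚ + 0ℚ) + ((a₀ * b₁ - a₁ * b₀) - (a₀ * b₁ - a₁ * b₀))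
  vanish = solve-∀ ℚ-ring
∑-δ²-by-parts (suc n) a b = begin
  L (suc (suc n))
    ≡⟨ ∑-snoc (suc n) (λ j → δ² a j * b j) ⟩
  L (suc n) + δ² a (suc n) * b (suc n)
    ≡⟨ cong (_+ δ² a (suc n) * b (suc n)) (∑-δ²-by-parts n a b) ⟩
  (R (suc n) + (W n - W 0)) + δ² a (suc n) * b (suc n)
    ≡⟨ step (R (suc n)) (a n) (a (suc n)) (a (suc (suc n))) (b n) (b (suc n)) (b (suc (suc n))) (W 0) ⟩
  (R (suc n) + a (suc n) * δ² b (suc n)) + (W (suc n) - W 0)
    ≡⟨ cong (_+ (W (suc n) - W 0)) (∑-snoc (suc n) (λ j → a j * δ² b j)) ⟨
  R (suc (suc n)) + (W (suc n) - W 0) ∎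
  where
  open ≡-Reasoning
  L R W : ℕ → ℚ
  L m = ∑[ j < m ] (δ² a (toℕ j) * b (toℕ j))
  R m = ∑[ j < m ] (a (toℕ j) * δ² b (toℕ j))
  W   = casoratian a b
  step : ∀ s a₀ a₁ a₂ b₀ b₁ b₂ w →
    (s + ((a₀ * b₁ - a₁ * b₀) - w)) + ((a₁ + a₁) - (a₀ + a₂)) * b₁
      ≡ (s + a₁ * ((b₁ + b₁) - (b₀ + b₂))) + ((a₁ * b₂ - a₂ * b₁) - w)
  step = solve-∀ ℚ-ring

∑-δ²-selfAdjoint : ∀ k (a b : ℕ → ℚ) → a 0 ≡ 0ℚ → a k ≡ 0ℚ → b 0 ≡ 0ℚ → b k ≡ 0ℚ →
  ∑[ j < k ] (δ² a (toℕ j) * b (toℕ j)) ≡ ∑[ j < k ] (a (toℕ j) * δ² b (toℕ j))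
∑-δ²-selfAdjoint zero    a b _  _  _  _  = refl
∑-δ²-selfAdjoint (suc n) a b a₀ aₖ b₀ bₖ =
  trans (∑-δ²-by-parts n a b) (trans (cong (R +_) boundary) (ℚ.+-identityʳ R))
  where
  R : ℚ
  R = ∑[ j < suc n ] (a (toℕ j) * δ² b (toℕ j))
  boundary : casoratian a b n - casoratian a b 0 ≡ 0ℚ
  boundary rewrite a₀ | aₖ | b₀ | bₖ = vanish (a n) (b n) (a 1) (b 1)
    where
    vanish : ∀ x y u v → (x * 0ℚ - 0ℚ * y) - (0ℚ * v - u * 0ℚ) ≡ 0ℚ
    vanish = solve-∀ ℚ-ring

-- As a function of c, tent k c j is piecewise linear, vanishes at c = 0 and c = k, and has its only kink at c = j.
tentArm : ℕ → ℕ → ℕ → Bool → ℕ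
tentArm k c j u = if u then j ℕ.* (k ℕ.∸ c) else c ℕ.* (k ℕ.∸ j)

tent : ℕ → ℕ → ℕ → ℕ
tent k c j = tentArm k c j true ⊓ tentArm k c j false

tent≤tentArm : ∀ k c j u → tent k c j ℕ.≤ tentArm k c j u
tent≤tentArm k c j true  = ℕ.m⊓n≤m _ _
tent≤tentArm k c j false = ℕ.m⊓n≤n _ _

if-≤ᵇ-≡-⊓ : ∀ m n → (if m ℕ.≤ᵇ n then m else n) ≡ m ⊓ n
if-≤ᵇ-≡-⊓ m n with m ℕ.≤ᵇ n | ℕ.≤ᵇ-reflects-≤ m n
... | true  | ofʸ m≤n = sym (ℕ.m≤n⇒m⊓n≡m m≤n)
... | false | ofⁿ m≰n = sym (ℕ.m≥n⇒m⊓n≡n (ℕ.≰⇒≥ m≰n))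

tent-left : ∀ {k c j} → j ℕ.≤ c → tent k c j ≡ j ℕ.* (k ℕ.∸ c)
tent-left {k} j≤c = ℕ.m≤n⇒m⊓n≡m (ℕ.*-mono-≤ j≤c (ℕ.∸-monoʳ-≤ k j≤c))

tent-right : ∀ {k c j} → c ℕ.≤ j → tent k c j ≡ c ℕ.* (k ℕ.∸ j)
tent-right {k} c≤j = ℕ.m≥n⇒m⊓n≡n (ℕ.*-mono-≤ c≤j (ℕ.∸-monoʳ-≤ k c≤j))

fromℕ-tent-left : ∀ {k c j} → j ℕ.≤ c → c ℕ.≤ k → fromℕ (tent k c j) ≡ fromℕ j * (fromℕ k - fromℕ c)
fromℕ-tent-left {j = j} j≤c c≤k =
  trans (cong fromℕ (tent-left j≤c)) (trans (fromℕ-* j _) (cong (fromℕ j *_) (fromℕ-∸ c≤k)))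

fromℕ-tent-right : ∀ {k c j} → c ℕ.≤ j → j ℕ.≤ k → fromℕ (tent k c j) ≡ fromℕ c * (fromℕ k - fromℕ j)
fromℕ-tent-right {c = c} c≤j j≤k =
  trans (cong fromℕ (tent-right c≤j)) (trans (fromℕ-* c _) (cong (fromℕ c *_) (fromℕ-∸ j≤k)))

δ²-tent-off : ∀ {k c} j → j ℕ.< k → c ℕ.≤ k → j ≢ c → δ² (fromℕ ∘ tent k c) j ≡ 0ℚ
δ²-tent-off zero _ _ _ = refl
δ²-tent-off {k} {c} (suc i) i+2≤k c≤k i+1≢c with ℕ.<-cmp (suc i) c
... | tri< i+1<c _ _ =
  trans (δ²-cong {fromℕ ∘ tent k c} i (fromℕ-tent-left (ℕ.≤-trans (ℕ.n≤1+n i) i+1≤c) c≤k)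
                                      (fromℕ-tent-left i+1≤c c≤k)
                                      (fromℕ-tent-left i+1<c c≤k))
        (linear (fromℕ i) (fromℕ k - fromℕ c))
  where
  i+1≤c : suc i ℕ.≤ c
  i+1≤c = ℕ.<⇒≤ i+1<c
  linear : ∀ x s → ((1ℚ + x) * s + (1ℚ + x) * s) - (x * s + (1ℚ + (1ℚ + x)) * s) ≡ 0ℚ
  linear = solve-∀ ℚ-ring
... | tri≈ _ i+1≡c _ = ⊥-elim (i+1≢c i+1≡c)
... | tri> _ _ c<i+1 =
  trans (δ²-cong {fromℕ ∘ tent k c} i (fromℕ-tent-right (ℕ.≤-pred c<i+1) (ℕ.≤-trans (ℕ.n≤1+n i) i+1≤k))
                                      (fromℕ-tent-right c≤i+1 i+1≤k)
                                      (fromℕ-tent-right (ℕ.m≤n⇒m≤1+n c≤i+1) i+2≤k))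
        (linear (fromℕ i) (fromℕ c) (fromℕ k))
  where
  i+1≤k : suc i ℕ.≤ k
  i+1≤k = ℕ.<⇒≤ i+2≤k
  c≤i+1 : c ℕ.≤ suc i
  c≤i+1 = ℕ.<⇒≤ c<i+1
  linear : ∀ x t K → (t * (K - (1ℚ + x)) + t * (K - (1ℚ + x))) - (t * (K - x) + t * (K - (1ℚ + (1ℚ + x)))) ≡ 0ℚ
  linear = solve-∀ ℚ-ring

δ²-tent-peak : ∀ {k} i → suc i ℕ.< k → δ² (fromℕ ∘ tent k (suc i)) (suc i) ≡ fromℕ k
δ²-tent-peak {k} i i+2≤k =
  trans (δ²-cong {fromℕ ∘ tent k (suc i)} i (fromℕ-tent-left (ℕ.n≤1+n i) i+1≤k)
                                            (fromℕ-tent-left ℕ.≤-refl i+1≤k)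
                                            (fromℕ-tent-right (ℕ.n≤1+n (suc i)) i+2≤k))
        (kink (fromℕ i) (fromℕ k))
  where
  i+1≤k : suc i ℕ.≤ k
  i+1≤k = ℕ.<⇒≤ i+2≤k
  kink : ∀ x K → ((1ℚ + x) * (K - (1ℚ + x)) + (1ℚ + x) * (K - (1ℚ + x)))
                   - (x * (K - (1ℚ + x)) + (1ℚ + x) * (K - (1ℚ + (1ℚ + x)))) ≡ K
  kink = solve-∀ ℚ-ring

weighted-δ²-tent-kink : ∀ (g : ℕ → ℚ) {k} c → g 0 ≡ 0ℚ → c ℕ.< k →
  g c * δ² (fromℕ ∘ tent k c) c ≡ fromℕ k * g c
weighted-δ²-tent-kink g {k} zero    g₀ _   =
  trans (ℚ.*-zeroʳ (g 0)) (sym (trans (cong (fromℕ k *_) g₀) (ℚ.*-zeroʳ (fromℕ k))))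
weighted-δ²-tent-kink g (suc i) _  i<k =
  trans (cong (g (suc i) *_) (δ²-tent-peak i i<k)) (ℚ.*-comm (g (suc i)) _)

tent-decomposition : ∀ (g : ℕ → ℚ) {k c} → g 0 ≡ 0ℚ → g k ≡ 0ℚ → c ℕ.≤ k →
  ∑[ j < k ] (δ² g (toℕ j) * fromℕ (tent k c (toℕ j))) ≡ fromℕ k * g c
tent-decomposition g {k} {c} g₀ gₖ c≤k = begin
  ∑[ j < k ] (δ² g (toℕ j) * t (toℕ j))  ≡⟨ ∑-δ²-selfAdjoint k g t g₀ gₖ refl tₖ ⟩
  ∑[ j < k ] (g (toℕ j) * δ² t (toℕ j))  ≡⟨ concentrated (ℕ.m≤n⇒m<n∨m≡n c≤k) ⟩
  fromℕ k * g c                          ∎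
  where
  open ≡-Reasoning
  t : ℕ → ℚ
  t = fromℕ ∘ tent k c
  tₖ : t k ≡ 0ℚ
  tₖ = cong fromℕ (trans (tent-right c≤k) (trans (cong (c ℕ.*_) (ℕ.n∸n≡0 k)) (ℕ.*-zeroʳ c)))
  off : ∀ (j : Fin k) → toℕ j ≢ c → g (toℕ j) * δ² t (toℕ j) ≡ 0ℚ
  off j j≢c = trans (cong (g (toℕ j) *_) (δ²-tent-off (toℕ j) (Fin.toℕ<n j) c≤k j≢c)) (ℚ.*-zeroʳ (g (toℕ j)))
  concentrated : c ℕ.< k ⊎ c ≡ k → ∑[ j < k ] (g (toℕ j) * δ² t (toℕ j)) ≡ fromℕ k * g c
  concentrated (inj₁ c<k) = begin
    ∑[ j < k ] (g (toℕ j) * δ² t (toℕ j))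
      ≡⟨ ∑-single _ c′ (λ j j≢c′ → off j (λ j≡c → j≢c′ (Fin.toℕ-injective (trans j≡c (sym toℕc))))) ⟩
    g (toℕ c′) * δ² t (toℕ c′)
      ≡⟨ cong (λ i → g i * δ² t i) toℕc ⟩
    g c * δ² t c
      ≡⟨ weighted-δ²-tent-kink g c g₀ c<k ⟩
    fromℕ k * g c ∎
    where
    c′ : Fin k
    c′ = fromℕ< c<k
    toℕc : toℕ c′ ≡ c
    toℕc = Fin.toℕ-fromℕ< c<k
  concentrated (inj₂ c≡k) = begin
    ∑[ j < k ] (g (toℕ j) * δ² t (toℕ j))
      ≡⟨ sum-cong-≗ {k} (λ j → off j (λ j≡c → ℕ.<⇒≢ (Fin.toℕ<n j) (trans j≡c c≡k))) ⟩
    ∑[ j < k ] 0ℚ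
      ≡⟨ sum-replicate-zero k ⟩
    0ℚ
      ≡⟨ ℚ.*-zeroʳ (fromℕ k) ⟨
    fromℕ k * 0ℚ
      ≡⟨ cong (fromℕ k *_) (trans (cong g c≡k) gₖ) ⟨
    fromℕ k * g c ∎

tent-combination : ∀ (g : ℕ → ℚ) {k c} → g 0 ≡ 0ℚ → g k ≡ 0ℚ → c ℕ.≤ k →
  g c ≡ ∑[ j < k ] ((δ² g (toℕ j) * 1/fromℕ k) * fromℕ (tent k c (toℕ j)))
tent-combination g {zero}  g₀ _  z≤n = g₀
tent-combination g {suc n} {c} g₀ gₖ c≤k = begin
  g c
    ≡⟨ 1/fromℕ-cancelˡ n (g c) ⟨
  1/k * (fromℕ (suc n) * g c)
    ≡⟨ cong (1/k *_) (tent-decomposition g g₀ gₖ c≤k) ⟨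
  1/k * ∑[ j < suc n ] (δ² g (toℕ j) * t j)
    ≡⟨ *-distribˡ-sum 1/k (λ j → δ² g (toℕ j) * t j) ⟩
  ∑[ j < suc n ] (1/k * (δ² g (toℕ j) * t j))
    ≡⟨ sum-cong-≗ {suc n} (λ j → reassoc 1/k (δ² g (toℕ j)) (t j)) ⟩
  ∑[ j < suc n ] ((δ² g (toℕ j) * 1/k) * t j) ∎
  where
  open ≡-Reasoning
  1/k : ℚ
  1/k = 1/fromℕ (suc n)
  t : Fin (suc n) → ℚ
  t j = fromℕ (tent (suc n) c (toℕ j))
  reassoc : ∀ x y z → x * (y * z) ≡ (y * x) * z
  reassoc = solve-∀ ℚ-ring

-- Profiles of cardinality-based functions

prefix : (k c : ℕ) → Subset k
prefix k       zero    = ∅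
prefix zero    (suc c) = []
prefix (suc k) (suc c) = true ∷ prefix k c

∣prefix∣ : ∀ {k c} → c ℕ.≤ k → ∣ prefix k c ∣ ≡ c
∣prefix∣ {k} z≤n       = ∣⊥∣≡0 k
∣prefix∣     (s≤s c≤k) = cong suc (∣prefix∣ c≤k)

prefix-full : ∀ k → prefix k k ≡ full
prefix-full zero    = refl
prefix-full (suc k) = cong (true ∷_) (prefix-full k)

-- prefixSkip k j = {0, …, j − 1} ∪ {j + 1}
prefixSkip : (k j : ℕ) → Subset k
prefixSkip (suc k)       (suc j) = true ∷ prefixSkip k j
prefixSkip (suc (suc k)) zero    = false ∷ true ∷ ∅
prefixSkip _             _       = ∅

prefix-∩-prefixSkip : ∀ {k j} → suc (suc j) ℕ.≤ k → prefix k (suc j) ∩ prefixSkip k j ≡ prefix k j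
prefix-∩-prefixSkip {suc (suc k)} {zero}  _         = cong (λ S → false ∷ false ∷ S) (∩-idem ∅)
prefix-∩-prefixSkip {suc k}       {suc j} (s≤s j≤k) = cong (true ∷_) (prefix-∩-prefixSkip j≤k)

prefix-∪-prefixSkip : ∀ {k j} → suc (suc j) ℕ.≤ k → prefix k (suc j) ∪ prefixSkip k j ≡ prefix k (suc (suc j))
prefix-∪-prefixSkip {suc (suc k)} {zero}  _         = cong (λ S → true ∷ true ∷ S) (∪-idem ∅)
prefix-∪-prefixSkip {suc k}       {suc j} (s≤s j≤k) = cong (true ∷_) (prefix-∪-prefixSkip j≤k)

∣prefixSkip∣ : ∀ {k j} → suc (suc j) ℕ.≤ k → ∣ prefixSkip k j ∣ ≡ suc j
∣prefixSkip∣ {suc (suc k)} {zero}  _         = cong suc (∣⊥∣≡0 k)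
∣prefixSkip∣ {suc k}       {suc j} (s≤s j≤k) = cong suc (∣prefixSkip∣ j≤k)

profile : ∀ {k} → (Subset k → ℚ) → ℕ → ℚ
profile {k} w c = w (prefix k c)

profile-∣∣ : ∀ {k} {w : Subset k → ℚ} → IsCardinalityBased w → ∀ S → w S ≡ profile w ∣ S ∣
profile-∣∣ {k} cardinality S = cardinality S (prefix k ∣ S ∣) (sym (∣prefix∣ (∣p∣≤n S)))

profile-0 : ∀ {k} {w : Subset k → ℚ} → IsSplittingFunction w → profile w 0 ≡ 0ℚ
profile-0 (_ , _ , _ , w∅≡0) = w∅≡0

profile-k : ∀ {k} {w : Subset k → ℚ} → IsSplittingFunction w → profile w k ≡ 0ℚ
profile-k {k} {w} (_ , _ , wfull≡0 , _) = trans (cong w (prefix-full k)) wfull≡0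

δ²-profile-nonneg : ∀ {k} {w : Subset k → ℚ} → IsCardinalityBased w → IsSubmodular w →
                    ∀ j → j ℕ.< k → 0ℚ ≤ δ² (profile w) j
δ²-profile-nonneg cardinality submodular zero    _     = ℚ.≤-refl
δ²-profile-nonneg {k} {w} cardinality submodular (suc j) j+2≤k = p≤q⇒0≤q-p (subst₂ _≤_
  (cong₂ _+_ (cong w (prefix-∩-prefixSkip j+2≤k)) (cong w (prefix-∪-prefixSkip j+2≤k)))
  (cong (profile w (suc j) +_) (cardinality _ _ (trans (∣prefixSkip∣ j+2≤k) (sym (∣prefix∣ (ℕ.<⇒≤ j+2≤k))))))
  (submodular (prefix k (suc j)) (prefixSkip k j)))

-- Star gadgets

star-aux-cut : ∀ {k} (S : Subset k) u p q →
  ∑[ v < k ] edgeCut (lookup S v) u p + ∑[ v < k ] edgeCut u (lookup S v) q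
    ≡ (if u then fromℕ (k ℕ.∸ ∣ S ∣) * q else fromℕ ∣ S ∣ * p)
star-aux-cut {k} S false p q = begin
  ∑[ v < k ] edgeCut (lookup S v) false p + ∑[ v < k ] 0ℚ
    ≡⟨ cong₂ _+_ (sum-cong-≗ {k} (λ v → cong (λ b → if b then p else 0ℚ) (Bool.∧-identityʳ (lookup S v))))
                 (sum-replicate-zero k) ⟩
  ∑[ v < k ] (if lookup S v then p else 0ℚ) + 0ℚ
    ≡⟨ ℚ.+-identityʳ _ ⟩
  ∑[ v < k ] (if lookup S v then p else 0ℚ)
    ≡⟨ ∑-count S p ⟩
  fromℕ ∣ S ∣ * p ∎
  where open ≡-Reasoning
star-aux-cut {k} S true p q = begin
  ∑[ v < k ] edgeCut (lookup S v) true p + ∑[ v < k ] (if not (lookup S v) then q else 0ℚ)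
    ≡⟨ cong₂ _+_ (trans (sum-cong-≗ {k} (λ v → cong (λ b → if b then p else 0ℚ) (Bool.∧-zeroʳ (lookup S v))))
                        (sum-replicate-zero k))
                 (sum-cong-≗ {k} (λ v → cong (λ b → if b then q else 0ℚ) (sym (Vec.lookup-map v not S)))) ⟩
  0ℚ + ∑[ v < k ] (if lookup (∁ S) v then q else 0ℚ)
    ≡⟨ ℚ.+-identityˡ _ ⟩
  ∑[ v < k ] (if lookup (∁ S) v then q else 0ℚ)
    ≡⟨ ∑-count (∁ S) q ⟩
  fromℕ ∣ ∁ S ∣ * q
    ≡⟨ cong (λ n → fromℕ n * q) (∣∁p∣≡n∸∣p∣ S) ⟩
  fromℕ (k ℕ.∸ ∣ S ∣) * q ∎
  where open ≡-Reasoning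

starWeight : ∀ {k m} → (Fin m → ℚ) → (Fin m → ℚ) → Fin k ⊎ Fin m → Fin k ⊎ Fin m → ℚ
starWeight P Q (inj₁ _) (inj₂ j) = P j
starWeight P Q (inj₂ j) (inj₁ _) = Q j
starWeight P Q _        _        = 0ℚ

starWeight-nonneg : ∀ {k m} {P Q : Fin m → ℚ} → (∀ j → 0ℚ ≤ P j) → (∀ j → 0ℚ ≤ Q j) →
                    ∀ (a b : Fin k ⊎ Fin m) → 0ℚ ≤ starWeight P Q a b
starWeight-nonneg P≥0 Q≥0 (inj₁ _) (inj₁ _) = ℚ.≤-refl
starWeight-nonneg P≥0 Q≥0 (inj₁ _) (inj₂ j) = P≥0 j
starWeight-nonneg P≥0 Q≥0 (inj₂ j) (inj₁ _) = Q≥0 j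
starWeight-nonneg P≥0 Q≥0 (inj₂ _) (inj₂ _) = ℚ.≤-refl

starGadget : ∀ k {m} (P Q : Fin m → ℚ) → (∀ j → 0ℚ ≤ P j) → (∀ j → 0ℚ ≤ Q j) → Gadget k
starGadget k {m} P Q P≥0 Q≥0 = record
  { aux           = m
  ; weight        = λ x y → starWeight P Q (splitAt k x) (splitAt k y)
  ; weight-nonneg = λ x y → starWeight-nonneg P≥0 Q≥0 (splitAt k x) (splitAt k y)
  }

module _ (k : ℕ) {m} (P Q : Fin m → ℚ) (P≥0 : ∀ j → 0ℚ ≤ P j) (Q≥0 : ∀ j → 0ℚ ≤ Q j)
         (S : Subset k) (U : Subset m) where

  private
    G : Gadget k
    G = starGadget k P Q P≥0 Q≥0

    side : Fin k ⊎ Fin m → Bool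
    side = [ lookup S , lookup U ]′

    h : Fin k ⊎ Fin m → Fin k ⊎ Fin m → ℚ
    h a b = edgeCut (side a) (side b) (starWeight P Q a b)

    row : Fin k ⊎ Fin m → ℚ
    row a = ∑[ v < k ] h a (inj₁ v) + ∑[ j < m ] h a (inj₂ j)

    ∑-edgeCut-0 : ∀ {n} (f : Fin n → Bool) b → ∑[ i < n ] edgeCut b (f i) 0ℚ ≡ 0ℚ
    ∑-edgeCut-0 {n} f b = trans (sum-cong-≗ {n} (λ i → edgeCut-0 b (f i))) (sum-replicate-zero n)

    row-inj₁ : ∀ v → row (inj₁ v) ≡ ∑[ j < m ] edgeCut (lookup S v) (lookup U j) (P j)
    row-inj₁ v = trans (cong (_+ ∑[ j < m ] edgeCut (lookup S v) (lookup U j) (P j))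
                             (∑-edgeCut-0 (lookup S) (lookup S v)))
                       (ℚ.+-identityˡ _)

    row-inj₂ : ∀ j → row (inj₂ j) ≡ ∑[ v < k ] edgeCut (lookup U j) (lookup S v) (Q j)
    row-inj₂ j = trans (cong (∑[ v < k ] edgeCut (lookup U j) (lookup S v) (Q j) +_)
                             (∑-edgeCut-0 (lookup U) (lookup U j)))
                       (ℚ.+-identityʳ _)

  starGadget-cut-blocks : gadgetCut (starGadget k P Q P≥0 Q≥0) (S ++ U) ≡
    ∑[ v < k ] ∑[ j < m ] edgeCut (lookup S v) (lookup U j) (P j)
      + ∑[ j < m ] ∑[ v < k ] edgeCut (lookup U j) (lookup S v) (Q j)
  starGadget-cut-blocks = begin
    gadgetCut G (S ++ U)
      ≡⟨ gadgetCut≡∑ G (S ++ U) ⟩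
    ∑[ x < k ℕ.+ m ] ∑[ y < k ℕ.+ m ]
      edgeCut (lookup (S ++ U) x) (lookup (S ++ U) y) (starWeight P Q (splitAt k x) (splitAt k y))
      ≡⟨ sum-cong-≗ {k ℕ.+ m} (λ x → sum-cong-≗ {k ℕ.+ m} (λ y →
           cong₂ (λ a b → edgeCut a b (starWeight P Q (splitAt k x) (splitAt k y)))
                 (Vec.lookup-splitAt k S U x) (Vec.lookup-splitAt k S U y))) ⟩
    ∑[ x < k ℕ.+ m ] ∑[ y < k ℕ.+ m ] h (splitAt k x) (splitAt k y)
      ≡⟨ sum-cong-≗ {k ℕ.+ m} (λ x → ∑-splitAt k (h (splitAt k x))) ⟩
    ∑[ x < k ℕ.+ m ] row (splitAt k x)
      ≡⟨ ∑-splitAt k row ⟩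
    ∑[ v < k ] row (inj₁ v) + ∑[ j < m ] row (inj₂ j)
      ≡⟨ cong₂ _+_ (sum-cong-≗ {k} row-inj₁) (sum-cong-≗ {m} row-inj₂) ⟩
    ∑[ v < k ] ∑[ j < m ] edgeCut (lookup S v) (lookup U j) (P j)
      + ∑[ j < m ] ∑[ v < k ] edgeCut (lookup U j) (lookup S v) (Q j) ∎
    where open ≡-Reasoning

  starGadget-cut : gadgetCut (starGadget k P Q P≥0 Q≥0) (S ++ U) ≡
    ∑[ j < m ] (if lookup U j then fromℕ (k ℕ.∸ ∣ S ∣) * Q j else fromℕ ∣ S ∣ * P j)
  starGadget-cut = begin
    gadgetCut G (S ++ U)
      ≡⟨ starGadget-cut-blocks ⟩
    ∑[ v < k ] ∑[ j < m ] edgeCut (lookup S v) (lookup U j) (P j)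
      + ∑[ j < m ] ∑[ v < k ] edgeCut (lookup U j) (lookup S v) (Q j)
      ≡⟨ cong (_+ _) (∑-comm (λ v j → edgeCut (lookup S v) (lookup U j) (P j))) ⟩
    ∑[ j < m ] ∑[ v < k ] edgeCut (lookup S v) (lookup U j) (P j)
      + ∑[ j < m ] ∑[ v < k ] edgeCut (lookup U j) (lookup S v) (Q j)
      ≡⟨ ∑-distrib-+ (λ j → ∑[ v < k ] edgeCut (lookup S v) (lookup U j) (P j))
                     (λ j → ∑[ v < k ] edgeCut (lookup U j) (lookup S v) (Q j)) ⟨
    ∑[ j < m ] (∑[ v < k ] edgeCut (lookup S v) (lookup U j) (P j)
                  + ∑[ v < k ] edgeCut (lookup U j) (lookup S v) (Q j))
      ≡⟨ sum-cong-≗ {m} (λ j → star-aux-cut S (lookup U j) (P j) (Q j)) ⟩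
    ∑[ j < m ] (if lookup U j then fromℕ (k ℕ.∸ ∣ S ∣) * Q j else fromℕ ∣ S ∣ * P j) ∎
    where open ≡-Reasoning

take-++ : ∀ {A : Set} {m n} (xs : Vec A m) (ys : Vec A n) → take m (xs ++ ys) ≡ xs
take-++ {m = m} xs ys = Vec.++-injectiveˡ (take m (xs ++ ys)) xs (Vec.take++drop≡id m (xs ++ ys))

module _ (k : ℕ) (r : Fin k → ℚ) (r≥0 : ∀ j → 0ℚ ≤ r j) where

  private
    P Q : Fin k → ℚ
    P j = r j * fromℕ (k ℕ.∸ toℕ j)
    Q j = r j * fromℕ (toℕ j)

    P≥0 : ∀ j → 0ℚ ≤ P j
    P≥0 j = *-nonneg (r≥0 j) (fromℕ-nonneg (k ℕ.∸ toℕ j))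

    Q≥0 : ∀ j → 0ℚ ≤ Q j
    Q≥0 j = *-nonneg (r≥0 j) (fromℕ-nonneg (toℕ j))

  tentGadget : Gadget k
  tentGadget = starGadget k P Q P≥0 Q≥0

  tentGadget-cut : ∀ (S U : Subset k) →
    gadgetCut tentGadget (S ++ U) ≡ ∑[ j < k ] (r j * fromℕ (tentArm k ∣ S ∣ (toℕ j) (lookup U j)))
  tentGadget-cut S U = trans (starGadget-cut k P Q P≥0 Q≥0 S U) (sum-cong-≗ {k} λ j → arm (lookup U j) j)
    where
    c : ℕ
    c = ∣ S ∣
    arm : ∀ u j → (if u then fromℕ (k ℕ.∸ c) * Q j else fromℕ c * P j) ≡ r j * fromℕ (tentArm k c (toℕ j) u)
    arm true  j = trans (swap (fromℕ (k ℕ.∸ c)) (r j) (fromℕ (toℕ j)))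
                        (cong (r j *_) (sym (fromℕ-* (toℕ j) (k ℕ.∸ c))))
      where
      swap : ∀ x y z → x * (y * z) ≡ y * (z * x)
      swap = solve-∀ ℚ-ring
    arm false j = trans (swap (fromℕ c) (r j) (fromℕ (k ℕ.∸ toℕ j)))
                        (cong (r j *_) (sym (fromℕ-* c (k ℕ.∸ toℕ j))))
      where
      swap : ∀ x y z → x * (y * z) ≡ y * (x * z)
      swap = solve-∀ ℚ-ring

  tentGadget-models : ∀ (w : Subset k → ℚ) → (∀ S → w S ≡ ∑[ j < k ] (r j * fromℕ (tent k ∣ S ∣ (toℕ j)))) →
                      Models tentGadget w
  tentGadget-models w w≡ S = (S ++ U* , take-++ S U* , optimal) , lower-bound
    where
    c : ℕ
    c = ∣ S ∣
    U* : Subset k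
    U* = tabulate λ j → tentArm k c (toℕ j) true ℕ.≤ᵇ tentArm k c (toℕ j) false

    optimal : gadgetCut tentGadget (S ++ U*) ≡ w S
    optimal = begin
      gadgetCut tentGadget (S ++ U*)
        ≡⟨ tentGadget-cut S U* ⟩
      ∑[ j < k ] (r j * fromℕ (tentArm k c (toℕ j) (lookup U* j)))
        ≡⟨ sum-cong-≗ {k} (λ j → cong (λ n → r j * fromℕ n) (cheaper-arm j)) ⟩
      ∑[ j < k ] (r j * fromℕ (tent k c (toℕ j)))
        ≡⟨ w≡ S ⟨
      w S ∎
      where
      open ≡-Reasoning
      cheaper-arm : ∀ j → tentArm k c (toℕ j) (lookup U* j) ≡ tent k c (toℕ j)
      cheaper-arm j = trans (cong (tentArm k c (toℕ j)) (Vec.lookup∘tabulate _ j))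
                            (if-≤ᵇ-≡-⊓ (tentArm k c (toℕ j) true) (tentArm k c (toℕ j) false))

    lower-bound : ∀ T → take k T ≡ S → w S ≤ gadgetCut tentGadget T
    lower-bound T T∩e≡S = begin
      w S
        ≡⟨ w≡ S ⟩
      ∑[ j < k ] (r j * fromℕ (tent k c (toℕ j)))
        ≤⟨ ∑-mono-≤ (λ j → ℚ.*-monoˡ-≤-nonNeg (r j) {{ℚ.nonNegative (r≥0 j)}}
                            (fromℕ-mono-≤ (tent≤tentArm k c (toℕ j) (lookup U j)))) ⟩
      ∑[ j < k ] (r j * fromℕ (tentArm k c (toℕ j) (lookup U j)))
        ≡⟨ tentGadget-cut S U ⟨
      gadgetCut tentGadget (S ++ U)
        ≡⟨ cong (gadgetCut tentGadget) (trans (cong (_++ U) (sym T∩e≡S)) (Vec.take++drop≡id k T)) ⟩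
      gadgetCut tentGadget T ∎
      where
      open ℚ.≤-Reasoning
      U : Subset k
      U = drop k T

submodular⇒modeled : ∀ {k} (w : Subset k → ℚ) → IsSplittingFunction w → IsCardinalityBased w →
                     IsSubmodular w → Σ (Gadget k) λ G → Models G w
submodular⇒modeled {k} w splitting cardinality submodular =
  tentGadget k r r≥0 , tentGadget-models k r r≥0 w w≡
  where
  r : Fin k → ℚ
  r j = δ² (profile w) (toℕ j) * 1/fromℕ k
  r≥0 : ∀ j → 0ℚ ≤ r j
  r≥0 j = *-nonneg (δ²-profile-nonneg cardinality submodular (toℕ j) (Fin.toℕ<n j)) (1/fromℕ-nonneg k)
  w≡ : ∀ S → w S ≡ ∑[ j < k ] (r j * fromℕ (tent k ∣ S ∣ (toℕ j)))
  w≡ S = trans (profile-∣∣ cardinality S)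
               (tent-combination (profile w) (profile-0 splitting) (profile-k splitting) (∣p∣≤n S))

theorem4p6 : ∀ (n : ℕ) (H : Hypergraph n) (w : SplittingFunctions H)
               → (∀ e → IsSplittingFunction (w e))
               → (∀ e → IsCardinalityBased (w e))
               → (GraphReducible H w ⇔ (∀ e → IsSubmodular (w e)))
theorem4p6 n H w splitting cardinality = mk⇔
  (λ reducible e → modeled⇒submodular (reducible e))
  (λ submodular e → submodular⇒modeled (w e) (splitting e) (cardinality e) (submodular e))
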